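{- Let $k\ge 2$ and $i\in\{1,\dots,k-1\}$, and for $0\le j\le k$ let $\lambda_j=\sum_{\ell=0}^{k-i}(-1)^\ell\binom{j}{\ell}\binom{k-j}{i-j+\ell}^2$ be the eigenvalues of $J(2k,k,i)$. If $\binom{k}{i}$, $\binom{k-1}{i}$ and $k$ are all odd, then $\lambda_{k-i+1}-\lambda_{k-i-1}\equiv 2\pmod 4$.
   Context: $J(2k,k,i)$ is the graph on the $k$-subsets of $\{1,\dots,2k\}$ with $P\sim Q$ iff $|P\cap Q|=i$. Binomial coefficients $\binom{a}{b}$ are $0$ when $b<0$ or $b>a\ge 0$. -}

module Defs where

open import Data.Nat using (ℕ; zero; suc; _∸_)
open import Data.Nat.Combinatorics using (_C_)
open import Data.Integer using (ℤ; +_; -[1+_]; _+_; _-_; _*_; -_)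

-- Binomial coefficient with natural top and integer bottom;
-- zero when the bottom index is negative (and, via _C_, when it exceeds the top).
binomℤ : ℕ → ℤ → ℤ
binomℤ a (+ b)      = + (a C b)
binomℤ a -[1+ _ ]   = + 0

sgn : ℕ → ℤ
sgn zero          = + 1
sgn (suc zero)    = - (+ 1)
sgn (suc (suc n)) = sgn n

sumTo : ℕ → (ℕ → ℤ) → ℤ
sumTo zero    f = f 0
sumTo (suc n) f = sumTo n f + f (suc n)

eig : (k i j : ℕ) → ℤ
eig k i j = sumTo (k ∸ i) λ ℓ →
  sgn ℓ * (+ (j C ℓ)) * (binomℤ (k ∸ j) ((+ i - + j) + + ℓ) * binomℤ (k ∸ j) ((+ i - + j) + + ℓ))

module Submission where

-- Put k = a + n + 2 and i = n + 1, so that the two eigenvalues are λ_{a+2} and λ_a. Pascal's rule applied twice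
-- to the weights C(a+2, ℓ) of λ_{a+2} (an alternating summation by parts) and twice to the squared C(n+2, ·) of λ_a
-- writes both as sums over ℓ ≤ a of C(a, ℓ) times polynomials in three consecutive coefficients C(n, ·); comparing
-- them term by term gives λ_{a+2} − λ_a ≡ 2P (mod 4) with P = Σ_t C(a,t) (C(n,t)² + C(n,t−1) C(n,t+1)).
-- It remains to see that P is odd. The parity hypotheses force k odd and i even, i.e. a = 2A and n = 2J + 1, and
-- Lucas's theorem for the last binary digit reduces P mod 2 to Σ_u C(A,u) C(J,u) [C(J,u−1) even]. Halving once
-- more, this sum becomes either Σ_u C(A′,u) C(J′,u) ≡ C(A′+J′, J′) (Vandermonde mod 2) or a sum of the same shape
-- for (A′, J′); either way it is odd because C(A+J+1, J+1) ≡ C(k−1, i) (mod 2) is.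

module BinomialsModTwo where

  open import Function using (_∘_)
  open import Level using (0ℓ)
  open import Data.Maybe using (just; nothing)
  open import Data.Nat using (ℕ; zero; suc; _+_; _*_; _≤_; _<_; _≤′_; ≤′-refl; ≤′-step; z≤n; s≤s; parity)
  open import Data.Nat.Properties using (+-suc; ≤-refl; ≤-trans; n≤1+n; ≤⇒≤′; ≤′⇒≤)
  open import Data.Nat.Combinatorics using (_C_; nCk+nC[k+1]≡[n+1]C[k+1]; k>n⇒nCk≡0; nC1≡n; nCn≡1)
  open import Data.Nat.Induction using (<-rec)
  open import Data.Parity.Base using (Parity; 0ℙ; 1ℙ; _⁻¹) renaming (_+_ to infixl 6 _⊕_; _*_ to infixl 7 _·_)
  open import Data.Parity.Properties using (+-*-commutativeRing; +-homo-+; *-homo-*; +-identityʳ; +-assoc; *-identityʳ; *-zeroʳ; *-distribˡ-+)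
  open import Relation.Binary.PropositionalEquality
  open ≡-Reasoning
  open import Tactic.RingSolver using (solve-∀)
  open import Tactic.RingSolver.Core.AlmostCommutativeRing using (AlmostCommutativeRing; fromCommutativeRing)

  double : ℕ → ℕ
  double zero    = zero
  double (suc n) = suc (suc (double n))

  double-+ : ∀ m n → double (m + n) ≡ double m + double n
  double-+ zero    n = refl
  double-+ (suc m) n = cong (λ k → suc (suc k)) (double-+ m n)

  double≡+ : ∀ n → double n ≡ n + n
  double≡+ zero    = refl
  double≡+ (suc n) = cong suc (trans (cong suc (double≡+ n)) (sym (+-suc n n)))

  n≤double : ∀ n → n ≤ double n
  n≤double zero    = z≤n
  n≤double (suc n) = s≤s (≤-trans (n≤double n) (n≤1+n _))

  double-cancel-≤ : ∀ {m n} → double m ≤ double n → m ≤ n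
  double-cancel-≤ {zero}          _                 = z≤n
  double-cancel-≤ {suc m} {suc n} (s≤s (s≤s dm≤dn)) = s≤s (double-cancel-≤ dm≤dn)

  parity-double : ∀ n → parity (double n) ≡ 0ℙ
  parity-double zero    = refl
  parity-double (suc n) = parity-double n

  data Halving : ℕ → Set where
    even : ∀ h → Halving (double h)
    odd  : ∀ h → Halving (suc (double h))

  halving : ∀ n → Halving n
  halving zero = even zero
  halving (suc n) with halving n
  ... | even h = odd h
  ... | odd h  = even (suc h)

  half : ∀ {n} → Halving n → ℕ
  half (even h) = h
  half (odd h)  = h

  bit : ∀ {n} → Halving n → Parity
  bit (even _) = 0ℙ
  bit (odd _)  = 1ℙ

  ≤-suc-double-half : ∀ {n} (h : Halving n) → n ≤ suc (double (half h))
  ≤-suc-double-half (even h) = n≤1+n _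
  ≤-suc-double-half (odd h)  = ≤-refl

  binomℙ : ℕ → ℕ → Parity
  binomℙ n t = parity (n C t)

  binomℙ-pascal : ∀ n t → binomℙ (suc n) (suc t) ≡ binomℙ n t ⊕ binomℙ n (suc t)
  binomℙ-pascal n t = trans (cong parity (sym (nCk+nC[k+1]≡[n+1]C[k+1] n t))) (+-homo-+ (n C t) (n C suc t))


  ⊕-cancel-middle : ∀ p q r → (p ⊕ q) ⊕ (q ⊕ r) ≡ p ⊕ r
  ⊕-cancel-middle 0ℙ 0ℙ r = refl
  ⊕-cancel-middle 0ℙ 1ℙ 0ℙ = refl
  ⊕-cancel-middle 0ℙ 1ℙ 1ℙ = refl
  ⊕-cancel-middle 1ℙ 0ℙ r = refl
  ⊕-cancel-middle 1ℙ 1ℙ 0ℙ = refl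
  ⊕-cancel-middle 1ℙ 1ℙ 1ℙ = refl

  binomℙ-pascal₂ : ∀ n t → binomℙ (2 + n) (2 + t) ≡ binomℙ n t ⊕ binomℙ n (2 + t)
  binomℙ-pascal₂ n t = begin
    binomℙ (2 + n) (2 + t)
      ≡⟨ binomℙ-pascal (suc n) (suc t) ⟩
    binomℙ (1 + n) (1 + t) ⊕ binomℙ (1 + n) (2 + t)
      ≡⟨ cong₂ _⊕_ (binomℙ-pascal n t) (binomℙ-pascal n (suc t)) ⟩
    (binomℙ n t ⊕ binomℙ n (1 + t)) ⊕ (binomℙ n (1 + t) ⊕ binomℙ n (2 + t))
      ≡⟨ ⊕-cancel-middle (binomℙ n t) (binomℙ n (1 + t)) (binomℙ n (2 + t)) ⟩
    binomℙ n t ⊕ binomℙ n (2 + t)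
      ∎

  binomℙ-beyond : ∀ {n t} → n < t → binomℙ n t ≡ 0ℙ
  binomℙ-beyond n<t = cong parity (k>n⇒nCk≡0 n<t)

  binomℙ-even-even : ∀ n t → binomℙ (double n) (double t) ≡ binomℙ n t
  binomℙ-even-even zero    zero    = refl
  binomℙ-even-even zero    (suc t) = refl
  binomℙ-even-even (suc n) zero    = refl
  binomℙ-even-even (suc n) (suc t) = begin
    binomℙ (double (suc n)) (double (suc t))
      ≡⟨ binomℙ-pascal₂ (double n) (double t) ⟩
    binomℙ (double n) (double t) ⊕ binomℙ (double n) (double (suc t))
      ≡⟨ cong₂ _⊕_ (binomℙ-even-even n t) (binomℙ-even-even n (suc t)) ⟩
    binomℙ n t ⊕ binomℙ n (suc t)
      ≡⟨ binomℙ-pascal n t ⟨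
    binomℙ (suc n) (suc t)
      ∎

  binomℙ-even-odd : ∀ n t → binomℙ (double n) (suc (double t)) ≡ 0ℙ
  binomℙ-even-odd zero    t       = refl
  binomℙ-even-odd (suc n) zero    = trans (cong parity (nC1≡n (double (suc n)))) (parity-double (suc n))
  binomℙ-even-odd (suc n) (suc t) = begin
    binomℙ (double (suc n)) (suc (double (suc t)))
      ≡⟨ binomℙ-pascal₂ (double n) (suc (double t)) ⟩
    binomℙ (double n) (suc (double t)) ⊕ binomℙ (double n) (suc (double (suc t)))
      ≡⟨ cong₂ _⊕_ (binomℙ-even-odd n t) (binomℙ-even-odd n (suc t)) ⟩
    0ℙ
      ∎

  binomℙ-double : ∀ {n} (h : Halving n) t → binomℙ n (double t) ≡ binomℙ (half h) t
  binomℙ-double (even h) t       = binomℙ-even-even h t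
  binomℙ-double (odd h)  zero    = refl
  binomℙ-double (odd h)  (suc t) = begin
    binomℙ (suc (double h)) (double (suc t))
      ≡⟨ binomℙ-pascal (double h) (suc (double t)) ⟩
    binomℙ (double h) (suc (double t)) ⊕ binomℙ (double h) (double (suc t))
      ≡⟨ cong₂ _⊕_ (binomℙ-even-odd h t) (binomℙ-even-even h (suc t)) ⟩
    binomℙ h (suc t)
      ∎

  binomℙ-suc-double : ∀ {n} (h : Halving n) t → binomℙ n (suc (double t)) ≡ bit h · binomℙ (half h) t
  binomℙ-suc-double (even h) t = binomℙ-even-odd h t
  binomℙ-suc-double (odd h)  t = begin
    binomℙ (suc (double h)) (suc (double t))
      ≡⟨ binomℙ-pascal (double h) (double t) ⟩
    binomℙ (double h) (double t) ⊕ binomℙ (double h) (suc (double t))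
      ≡⟨ cong₂ _⊕_ (binomℙ-even-even h t) (binomℙ-even-odd h t) ⟩
    binomℙ h t ⊕ 0ℙ
      ≡⟨ +-identityʳ _ ⟩
    binomℙ h t
      ∎

  double-+-suc : ∀ m n → double m + suc (double n) ≡ suc (double (m + n))
  double-+-suc m n = trans (+-suc (double m) (double n)) (cong suc (sym (double-+ m n)))

  binomℙ-carry : ∀ {x y} (hx : Halving x) (hy : Halving y) →
    binomℙ (x + y) y ≡ (1ℙ ⊕ (bit hx · bit hy)) · binomℙ (half hx + half hy) (half hy)
  binomℙ-carry (even x) (even y) =
    trans (cong (λ m → binomℙ m (double y)) (sym (double-+ x y))) (binomℙ-even-even (x + y) y)
  binomℙ-carry (even x) (odd y) =
    trans (cong (λ m → binomℙ m (suc (double y))) (double-+-suc x y)) (binomℙ-suc-double (odd (x + y)) y)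
  binomℙ-carry (odd x) (even y) =
    trans (cong (λ m → binomℙ (suc m) (double y)) (sym (double-+ x y))) (binomℙ-double (odd (x + y)) y)
  binomℙ-carry (odd x) (odd y) =
    trans (cong (λ m → binomℙ (suc m) (suc (double y))) (double-+-suc x y)) (binomℙ-even-odd (suc (x + y)) y)

  parityRing : AlmostCommutativeRing 0ℓ 0ℓ
  parityRing = fromCommutativeRing +-*-commutativeRing λ { 0ℙ → just refl ; _ → nothing }

  sumℙ : ℕ → (ℕ → Parity) → Parity
  sumℙ zero    f = f 0
  sumℙ (suc N) f = sumℙ N f ⊕ f (suc N)

  sumℙ-cong : ∀ N {f g} → (∀ t → t ≤ N → f t ≡ g t) → sumℙ N f ≡ sumℙ N g
  sumℙ-cong zero    f≗g = f≗g 0 z≤n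
  sumℙ-cong (suc N) f≗g =
    cong₂ _⊕_ (sumℙ-cong N (λ t t≤N → f≗g t (≤-trans t≤N (n≤1+n N)))) (f≗g (suc N) ≤-refl)

  sumℙ-support : ∀ {M N f} → (∀ t → M < t → f t ≡ 0ℙ) → M ≤ N → sumℙ N f ≡ sumℙ M f
  sumℙ-support {M} {N} {f} vanish M≤N = go (≤⇒≤′ M≤N)
    where
    go : ∀ {N} → M ≤′ N → sumℙ N f ≡ sumℙ M f
    go ≤′-refl                 = refl
    go {suc N} (≤′-step M≤′N) = begin
      sumℙ N f ⊕ f (suc N) ≡⟨ cong (sumℙ N f ⊕_) (vanish (suc N) (s≤s (≤′⇒≤ M≤′N))) ⟩
      sumℙ N f ⊕ 0ℙ        ≡⟨ +-identityʳ _ ⟩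
      sumℙ N f             ≡⟨ go M≤′N ⟩
      sumℙ M f             ∎

  sumℙ-pairs : ∀ M f → sumℙ (suc (double M)) f ≡ sumℙ M (λ w → f (double w) ⊕ f (suc (double w)))
  sumℙ-pairs zero    f = refl
  sumℙ-pairs (suc M) f =
    trans (+-assoc (sumℙ (suc (double M)) f) _ _)
          (cong (_⊕ (f (double (suc M)) ⊕ f (suc (double (suc M))))) (sumℙ-pairs M f))

  sumℙ-*ˡ : ∀ N c f → sumℙ N (λ t → c · f t) ≡ c · sumℙ N f
  sumℙ-*ˡ zero    c f = refl
  sumℙ-*ˡ (suc N) c f = trans (cong (_⊕ c · f (suc N)) (sumℙ-*ˡ N c f)) (sym (*-distribˡ-+ c _ _))

  sumℙ-halve : ∀ {x N} (hx : Halving x) (r : ℕ → Parity) → x ≤ N →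
    sumℙ N (λ t → binomℙ x t · r t) ≡
    sumℙ (half hx) (λ w → binomℙ (half hx) w · (r (double w) ⊕ (bit hx · r (suc (double w)))))
  sumℙ-halve {x} {N} hx r x≤N = begin
    sumℙ N F                         ≡⟨ sumℙ-support vanish x≤N ⟩
    sumℙ x F                         ≡⟨ sumℙ-support vanish (≤-suc-double-half hx) ⟨
    sumℙ (suc (double (half hx))) F  ≡⟨ sumℙ-pairs (half hx) F ⟩
    sumℙ (half hx) (λ w → F (double w) ⊕ F (suc (double w)))
                                     ≡⟨ sumℙ-cong (half hx) (λ w _ → pair w) ⟩
    sumℙ (half hx) (λ w → binomℙ (half hx) w · (r (double w) ⊕ (bit hx · r (suc (double w)))))
                                     ∎
    where
    F : ℕ → Parity
    F t = binomℙ x t · r t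
    vanish : ∀ t → x < t → F t ≡ 0ℙ
    vanish t x<t = cong (_· r t) (binomℙ-beyond x<t)
    factor : ∀ p b u v → p · u ⊕ (b · p) · v ≡ p · (u ⊕ (b · v))
    factor = solve-∀ parityRing
    pair : ∀ w → F (double w) ⊕ F (suc (double w))
                 ≡ binomℙ (half hx) w · (r (double w) ⊕ (bit hx · r (suc (double w))))
    pair w = trans (cong₂ (λ p q → p · r (double w) ⊕ q · r (suc (double w)))
                          (binomℙ-double hx w) (binomℙ-suc-double hx w))
                   (factor (binomℙ (half hx) w) (bit hx) _ _)

  vandermondeℙ : ∀ x y {N} → x ≤ N → sumℙ N (λ v → binomℙ x v · binomℙ y v) ≡ binomℙ (x + y) y
  vandermondeℙ = <-rec Vandermonde step
    where
    Vandermonde : ℕ → Set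
    Vandermonde x = ∀ y {N} → x ≤ N → sumℙ N (λ v → binomℙ x v · binomℙ y v) ≡ binomℙ (x + y) y

    base : Vandermonde 0
    base y {N} 0≤N = begin
      sumℙ N (λ v → binomℙ 0 v · binomℙ y v)
        ≡⟨ sumℙ-support (λ t 0<t → cong (_· binomℙ y t) (binomℙ-beyond 0<t)) 0≤N ⟩
      1ℙ
        ≡⟨ cong parity (nCn≡1 y) ⟨
      binomℙ y y
        ∎

    halved : ∀ {x} (hx : Halving x) → Vandermonde (half hx) → Vandermonde x
    halved {x} hx ih y {N} x≤N = begin
      sumℙ N (λ v → binomℙ x v · binomℙ y v)
        ≡⟨ sumℙ-halve hx (binomℙ y) x≤N ⟩
      sumℙ x₁ (λ w → binomℙ x₁ w · (binomℙ y (double w) ⊕ (bit hx · binomℙ y (suc (double w)))))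
        ≡⟨ sumℙ-cong x₁ (λ w _ → pair w) ⟩
      sumℙ x₁ (λ w → carry · (binomℙ x₁ w · binomℙ y₁ w))
        ≡⟨ sumℙ-*ˡ x₁ carry _ ⟩
      carry · sumℙ x₁ (λ w → binomℙ x₁ w · binomℙ y₁ w)
        ≡⟨ cong (carry ·_) (ih y₁ ≤-refl) ⟩
      carry · binomℙ (x₁ + y₁) y₁
        ≡⟨ binomℙ-carry hx hy ⟨
      binomℙ (x + y) y
        ∎
      where
      hy : Halving y
      hy = halving y
      x₁ y₁ : ℕ
      x₁ = half hx
      y₁ = half hy
      carry : Parity
      carry = 1ℙ ⊕ (bit hx · bit hy)
      regroup : ∀ c b b′ d → c · (d ⊕ (b · (b′ · d))) ≡ (1ℙ ⊕ (b · b′)) · (c · d)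
      regroup = solve-∀ parityRing
      pair : ∀ w → binomℙ x₁ w · (binomℙ y (double w) ⊕ (bit hx · binomℙ y (suc (double w))))
                 ≡ carry · (binomℙ x₁ w · binomℙ y₁ w)
      pair w = trans (cong₂ (λ p q → binomℙ x₁ w · (p ⊕ (bit hx · q)))
                            (binomℙ-double hy w) (binomℙ-suc-double hy w))
                     (regroup (binomℙ x₁ w) (bit hx) (bit hy) (binomℙ y₁ w))

    step : ∀ x → (∀ {x₁} → x₁ < x → Vandermonde x₁) → Vandermonde x
    step x rec with halving x
    ... | even zero    = base
    ... | even (suc h) = halved (even (suc h)) (rec (s≤s (s≤s (n≤double h))))
    ... | odd h        = halved (odd h) (rec (s≤s (n≤double h)))

  binomPrev : ℕ → ℕ → ℕ
  binomPrev n zero    = 0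
  binomPrev n (suc t) = n C t

  binomPrevℙ : ℕ → ℕ → Parity
  binomPrevℙ n t = parity (binomPrev n t)

  binomPrevℙ-double : ∀ {n} (h : Halving n) t → binomPrevℙ n (double t) ≡ bit h · binomPrevℙ (half h) t
  binomPrevℙ-double h zero    = sym (*-zeroʳ (bit h))
  binomPrevℙ-double h (suc t) = binomℙ-suc-double h t

  oddAfterEvenℙ : ℕ → ℕ → Parity
  oddAfterEvenℙ n t = binomℙ n t · binomPrevℙ n t ⁻¹

  oddAfterEvenℙ-halve : ∀ {n} (h : Halving n) b t →
    oddAfterEvenℙ n (double t) ⊕ (b · oddAfterEvenℙ n (suc (double t))) ≡
    binomℙ (half h) t · (bit h · binomPrevℙ (half h) t) ⁻¹
  oddAfterEvenℙ-halve {n} h b t = begin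
    binomℙ n (double t) · binomPrevℙ n (double t) ⁻¹ ⊕ (b · (binomℙ n (suc (double t)) · binomℙ n (double t) ⁻¹))
      ≡⟨ cong₂ (λ p q → binomℙ n (double t) · p ⁻¹ ⊕ (b · q)) (binomPrevℙ-double h t) odd-term ⟩
    binomℙ n (double t) · (bit h · binomPrevℙ (half h) t) ⁻¹ ⊕ (b · 0ℙ)
      ≡⟨ cong₂ (λ p q → p · (bit h · binomPrevℙ (half h) t) ⁻¹ ⊕ q) (binomℙ-double h t) (*-zeroʳ b) ⟩
    binomℙ (half h) t · (bit h · binomPrevℙ (half h) t) ⁻¹ ⊕ 0ℙ
      ≡⟨ +-identityʳ _ ⟩
    binomℙ (half h) t · (bit h · binomPrevℙ (half h) t) ⁻¹
      ∎
    where
    b·c·c⁻¹≡0ℙ : ∀ b c → b · c · c ⁻¹ ≡ 0ℙ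
    b·c·c⁻¹≡0ℙ 0ℙ c  = refl
    b·c·c⁻¹≡0ℙ 1ℙ 0ℙ = refl
    b·c·c⁻¹≡0ℙ 1ℙ 1ℙ = refl
    odd-term : binomℙ n (suc (double t)) · binomℙ n (double t) ⁻¹ ≡ 0ℙ
    odd-term = trans (cong₂ (λ p q → p · q ⁻¹) (binomℙ-suc-double h t) (binomℙ-double h t))
                     (b·c·c⁻¹≡0ℙ (bit h) (binomℙ (half h) t))

  ·≡1ℙ⇒ʳ≡1ℙ : ∀ p q → p · q ≡ 1ℙ → q ≡ 1ℙ
  ·≡1ℙ⇒ʳ≡1ℙ 1ℙ q pq≡1 = pq≡1

  sumℙ-oddAfterEven : ∀ J A → binomℙ (A + suc J) (suc J) ≡ 1ℙ →
    sumℙ A (λ u → binomℙ A u · oddAfterEvenℙ J u) ≡ 1ℙ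
  sumℙ-oddAfterEven = <-rec OddSum step
    where
    OddSum : ℕ → Set
    OddSum J = ∀ A → binomℙ (A + suc J) (suc J) ≡ 1ℙ →
      sumℙ A (λ u → binomℙ A u · oddAfterEvenℙ J u) ≡ 1ℙ

    halved : ∀ {J A} (hJ : Halving J) (hA : Halving A) →
      sumℙ A (λ u → binomℙ A u · oddAfterEvenℙ J u) ≡
      sumℙ (half hA) (λ w → binomℙ (half hA) w · (binomℙ (half hJ) w · (bit hJ · binomPrevℙ (half hJ) w) ⁻¹))
    halved {J} hJ hA = trans (sumℙ-halve hA (oddAfterEvenℙ J) ≤-refl)
      (sumℙ-cong (half hA) (λ w _ → cong (binomℙ (half hA) w ·_) (oddAfterEvenℙ-halve hJ (bit hA) w)))

    step : ∀ J → (∀ {J₁} → J₁ < J → OddSum J₁) → OddSum J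
    step J rec A hyp with halving J | halving A
    ... | even J₁ | hA = begin
      sumℙ A (λ u → binomℙ A u · oddAfterEvenℙ J u)
        ≡⟨ halved (even J₁) hA ⟩
      sumℙ (half hA) (λ w → binomℙ (half hA) w · (binomℙ J₁ w · 1ℙ))
        ≡⟨ sumℙ-cong (half hA) (λ w _ → cong (binomℙ (half hA) w ·_) (*-identityʳ _)) ⟩
      sumℙ (half hA) (λ w → binomℙ (half hA) w · binomℙ J₁ w)
        ≡⟨ vandermondeℙ (half hA) J₁ ≤-refl ⟩
      binomℙ (half hA + J₁) J₁
        ≡⟨ ·≡1ℙ⇒ʳ≡1ℙ _ _ (trans (sym (binomℙ-carry hA (odd J₁))) hyp) ⟩
      1ℙ
        ∎
    ... | odd J₁  | hA = begin
      sumℙ A (λ u → binomℙ A u · oddAfterEvenℙ J u)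
        ≡⟨ halved (odd J₁) hA ⟩
      sumℙ (half hA) (λ w → binomℙ (half hA) w · oddAfterEvenℙ J₁ w)
        ≡⟨ rec (s≤s (n≤double J₁)) (half hA)
               (·≡1ℙ⇒ʳ≡1ℙ _ _ (trans (sym (binomℙ-carry hA (even (suc J₁)))) hyp)) ⟩
      1ℙ
        ∎

  sumℕ : ℕ → (ℕ → ℕ) → ℕ
  sumℕ zero    f = f 0
  sumℕ (suc N) f = sumℕ N f + f (suc N)

  parity-sumℕ : ∀ N f → parity (sumℕ N f) ≡ sumℙ N (parity ∘ f)
  parity-sumℕ zero    f = refl
  parity-sumℕ (suc N) f =
    trans (+-homo-+ (sumℕ N f) (f (suc N))) (cong (_⊕ parity (f (suc N))) (parity-sumℕ N f))

  quadSum : ℕ → ℕ → ℕ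
  quadSum a n = sumℕ a (λ t → (a C t) * ((n C t) * (n C t) + binomPrev n t * (n C suc t)))

  quadSum-odd : ∀ A J → binomℙ (A + suc J) (suc J) ≡ 1ℙ → parity (quadSum (double A) (suc (double J))) ≡ 1ℙ
  quadSum-odd A J hyp = begin
    parity (quadSum a n)
      ≡⟨ parity-sumℕ a _ ⟩
    sumℙ a (λ t → parity ((a C t) * ((n C t) * (n C t) + binomPrev n t * (n C suc t))))
      ≡⟨ sumℙ-cong a (λ t _ → homo t) ⟩
    sumℙ a (λ t → binomℙ a t · q t)
      ≡⟨ sumℙ-halve (even A) q ≤-refl ⟩
    sumℙ A (λ w → binomℙ A w · (q (double w) ⊕ 0ℙ))
      ≡⟨ sumℙ-cong A (λ w _ → cong (binomℙ A w ·_) (trans (+-identityʳ _) (q-double w))) ⟩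
    sumℙ A (λ w → binomℙ A w · oddAfterEvenℙ J w)
      ≡⟨ sumℙ-oddAfterEven J A hyp ⟩
    1ℙ
      ∎
    where
    a n : ℕ
    a = double A
    n = suc (double J)
    q : ℕ → Parity
    q t = binomℙ n t · binomℙ n t ⊕ binomPrevℙ n t · binomℙ n (suc t)
    homo : ∀ t → parity ((a C t) * ((n C t) * (n C t) + binomPrev n t * (n C suc t))) ≡ binomℙ a t · q t
    homo t = trans (*-homo-* (a C t) _) (cong (binomℙ a t ·_) (trans (+-homo-+ ((n C t) * (n C t)) _)
               (cong₂ _⊕_ (*-homo-* (n C t) (n C t)) (*-homo-* (binomPrev n t) (n C suc t)))))
    c·c⊕p·c≡c·p⁻¹ : ∀ c p → c · c ⊕ p · c ≡ c · p ⁻¹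
    c·c⊕p·c≡c·p⁻¹ 0ℙ 0ℙ = refl
    c·c⊕p·c≡c·p⁻¹ 0ℙ 1ℙ = refl
    c·c⊕p·c≡c·p⁻¹ 1ℙ 0ℙ = refl
    c·c⊕p·c≡c·p⁻¹ 1ℙ 1ℙ = refl
    q-double : ∀ w → q (double w) ≡ oddAfterEvenℙ J w
    q-double w = begin
      binomℙ n (double w) · binomℙ n (double w) ⊕ binomPrevℙ n (double w) · binomℙ n (suc (double w))
        ≡⟨ cong₂ (λ c p → c · c ⊕ p · binomℙ n (suc (double w))) (binomℙ-double (odd J) w) (binomPrevℙ-double (odd J) w) ⟩
      binomℙ J w · binomℙ J w ⊕ binomPrevℙ J w · binomℙ n (suc (double w))
        ≡⟨ cong (λ c → binomℙ J w · binomℙ J w ⊕ binomPrevℙ J w · c) (binomℙ-suc-double (odd J) w) ⟩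
      binomℙ J w · binomℙ J w ⊕ binomPrevℙ J w · binomℙ J w
        ≡⟨ c·c⊕p·c≡c·p⁻¹ (binomℙ J w) (binomPrevℙ J w) ⟩
      oddAfterEvenℙ J w
        ∎

module AlternatingSums where

  open import Data.Nat as ℕ using (ℕ; zero; suc; _∸_; _≤_; z≤n; s≤s; _≤?_; parity)
  open import Data.Nat.Properties as ℕ using (≤-refl; ≤-trans; n≤1+n; ≰⇒>; m≤n⇒∃[o]m+o≡n; m≤m+n; m<m+n; m+n∸n≡m; m+n∸m≡n; +-suc)
  open import Data.Nat.Combinatorics using (_C_; nCk+nC[k+1]≡[n+1]C[k+1]; k>n⇒nCk≡0; nCk≡nC[n∸k])
  open import Data.Integer using (ℤ; +_; -[1+_]; _+_; _-_; _*_; -_)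
  open import Data.Integer.Properties using (pos-+; pos-*; *-zeroʳ; +-identityʳ; +-identityˡ; +-assoc; +-comm; *-distribˡ-+; m-n≡m⊖n; ⊖-≥)
  open import Data.Integer.Divisibility.Signed using (_∣_; divides; ∣m∣n⇒∣m+n; ∣⇒∣ᵤ)
  import Data.Integer.Divisibility as Unsigned
  open import Data.Integer.Tactic.RingSolver using (solve-∀)
  open import Data.Parity.Base using (0ℙ; 1ℙ)
  open import Data.Parity.Properties using (p≢p⁻¹)
  open import Data.Empty using (⊥-elim)
  open import Data.Product using (_,_)
  open import Data.Sum using (_⊎_; inj₁; inj₂)
  open import Relation.Nullary using (yes; no)
  open import Relation.Binary.PropositionalEquality
  open ≡-Reasoning
  open import Defs
  open BinomialsModTwo using (sumℕ; binomPrev; quadSum; double≡+; even; odd; halving; parity-double)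

  sumTo-cong : ∀ N {f g} → (∀ t → t ≤ N → f t ≡ g t) → sumTo N f ≡ sumTo N g
  sumTo-cong zero    f≗g = f≗g 0 z≤n
  sumTo-cong (suc N) f≗g =
    cong₂ _+_ (sumTo-cong N (λ t t≤N → f≗g t (≤-trans t≤N (n≤1+n N)))) (f≗g (suc N) ≤-refl)

  sumTo-+ : ∀ N f g → sumTo N (λ t → f t + g t) ≡ sumTo N f + sumTo N g
  sumTo-+ zero    f g = refl
  sumTo-+ (suc N) f g = trans (cong (_+ (f (suc N) + g (suc N))) (sumTo-+ N f g))
    (interchange (sumTo N f) (sumTo N g) (f (suc N)) (g (suc N)))
    where
    interchange : ∀ a b c d → (a + b) + (c + d) ≡ (a + c) + (b + d)
    interchange = solve-∀

  sumTo-*ˡ : ∀ N c f → sumTo N (λ t → c * f t) ≡ c * sumTo N f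
  sumTo-*ˡ zero    c f = refl
  sumTo-*ˡ (suc N) c f = trans (cong (_+ c * f (suc N)) (sumTo-*ˡ N c f)) (sym (*-distribˡ-+ c _ _))

  sumTo-suc : ∀ N f → sumTo (suc N) f ≡ f 0 + sumTo N (λ t → f (suc t))
  sumTo-suc zero    f = refl
  sumTo-suc (suc N) f = trans (cong (_+ f (suc (suc N))) (sumTo-suc N f)) (+-assoc (f 0) _ _)

  sumTo-reverse : ∀ N f → sumTo N f ≡ sumTo N (λ t → f (N ∸ t))
  sumTo-reverse zero    f = refl
  sumTo-reverse (suc N) f = begin
    sumTo N f + f (suc N)                           ≡⟨ cong (_+ f (suc N)) (sumTo-reverse N f) ⟩
    sumTo N (λ t → f (N ∸ t)) + f (suc N)           ≡⟨ +-comm _ (f (suc N)) ⟩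
    f (suc N) + sumTo N (λ t → f (N ∸ t))           ≡⟨ sumTo-suc N (λ t → f (suc N ∸ t)) ⟨
    sumTo (suc N) (λ t → f (suc N ∸ t))             ∎

  sumTo-pos : ∀ N f → sumTo N (λ t → + f t) ≡ + sumℕ N f
  sumTo-pos zero    f = refl
  sumTo-pos (suc N) f = trans (cong (_+ + f (suc N)) (sumTo-pos N f)) (sym (pos-+ (sumℕ N f) (f (suc N))))

  sumTo-∣-cong : ∀ {m} N f g → (∀ t → t ≤ N → m ∣ f t - g t) → m ∣ sumTo N f - sumTo N g
  sumTo-∣-cong zero    f g m∣ = m∣ 0 z≤n
  sumTo-∣-cong {m} (suc N) f g m∣
    with sumTo-∣-cong N f g (λ t t≤N → m∣ t (≤-trans t≤N (n≤1+n N))) | m∣ (suc N) ≤-refl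
  ... | divides p eq | divides q eq′ = divides (p + q) (begin
    (sumTo N f + f (suc N)) - (sumTo N g + g (suc N))  ≡⟨ regroup (sumTo N f) (f (suc N)) (sumTo N g) (g (suc N)) ⟩
    (sumTo N f - sumTo N g) + (f (suc N) - g (suc N))  ≡⟨ cong₂ _+_ eq eq′ ⟩
    p * m + q * m                                      ≡⟨ distrib p q m ⟩
    (p + q) * m                                        ∎)
    where
    regroup : ∀ a b c d → (a + b) - (c + d) ≡ (a - c) + (b - d)
    regroup = solve-∀
    distrib : ∀ p q m → p * m + q * m ≡ (p + q) * m
    distrib = solve-∀

  sgn-suc : ∀ ℓ → sgn (suc ℓ) ≡ - sgn ℓ
  sgn-suc zero          = refl
  sgn-suc (suc zero)    = refl
  sgn-suc (suc (suc ℓ)) = sgn-suc ℓ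

  sgn≡±1 : ∀ ℓ → sgn ℓ ≡ + 1 ⊎ sgn ℓ ≡ - + 1
  sgn≡±1 zero          = inj₁ refl
  sgn≡±1 (suc zero)    = inj₂ refl
  sgn≡±1 (suc (suc ℓ)) = sgn≡±1 ℓ

  binomℤ-pascal : ∀ m x → binomℤ (suc m) x ≡ binomℤ m x + binomℤ m (x - + 1)
  binomℤ-pascal m (+ zero)  = refl
  binomℤ-pascal m (+ suc t) = cong +_ (trans (sym (nCk+nC[k+1]≡[n+1]C[k+1] m t)) (ℕ.+-comm (m C t) _))
  binomℤ-pascal m -[1+ t ]  = refl

  binomℤ-pascal₂ : ∀ m x → binomℤ (suc (suc m)) x ≡ binomℤ m x + + 2 * binomℤ m (x - + 1) + binomℤ m (x - + 2)
  binomℤ-pascal₂ m x = begin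
    binomℤ (suc (suc m)) x
      ≡⟨ binomℤ-pascal (suc m) x ⟩
    binomℤ (suc m) x + binomℤ (suc m) (x - + 1)
      ≡⟨ cong₂ _+_ (binomℤ-pascal m x) (binomℤ-pascal m (x - + 1)) ⟩
    binomℤ m x + binomℤ m (x - + 1) + (binomℤ m (x - + 1) + binomℤ m (x - + 1 - + 1))
      ≡⟨ cong (λ y → binomℤ m x + binomℤ m (x - + 1) + (binomℤ m (x - + 1) + binomℤ m y)) (minus-two x) ⟩
    binomℤ m x + binomℤ m (x - + 1) + (binomℤ m (x - + 1) + binomℤ m (x - + 2))
      ≡⟨ collect (binomℤ m x) (binomℤ m (x - + 1)) (binomℤ m (x - + 2)) ⟩
    binomℤ m x + + 2 * binomℤ m (x - + 1) + binomℤ m (x - + 2)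
      ∎
    where
    minus-two : ∀ x → x - + 1 - + 1 ≡ x - + 2
    minus-two = solve-∀
    collect : ∀ a b c → a + b + (b + c) ≡ a + + 2 * b + c
    collect = solve-∀

  binomℤ-sym : ∀ n x → binomℤ n (+ n - x) ≡ binomℤ n x
  binomℤ-sym n (+ t) with t ≤? n
  ... | yes t≤n = trans (cong (binomℤ n) (trans (m-n≡m⊖n n t) (⊖-≥ t≤n))) (cong +_ (sym (nCk≡nC[n∸k] t≤n)))
  ... | no t≰n with m≤n⇒∃[o]m+o≡n (≰⇒> t≰n)
  ...   | o , refl =
    trans (cong (binomℤ n) (overshoot (+ n) (+ o))) (cong +_ (sym (k>n⇒nCk≡0 (s≤s (m≤m+n n o)))))
    where
    overshoot : ∀ n o → n - (+ 1 + n + o) ≡ - (+ 1 + o)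
    overshoot = solve-∀
  binomℤ-sym n -[1+ t ] = cong +_ (k>n⇒nCk≡0 (m<m+n n (s≤s z≤n)))

  binomℤ-pred : ∀ n t → binomℤ n (+ t - + 1) ≡ + binomPrev n t
  binomℤ-pred n zero    = refl
  binomℤ-pred n (suc t) = refl

  zero-coefficient : ∀ s {c} y → c ≡ 0 → s * + c * y ≡ + 0
  zero-coefficient s y refl = cong (_* y) (*-zeroʳ s)

  Δ : (ℕ → ℤ) → ℕ → ℤ
  Δ h ℓ = h ℓ - h (suc ℓ)

  sumTo-alternating-pascal : ∀ m h →
    sumTo (suc m) (λ ℓ → sgn ℓ * + (suc m C ℓ) * h ℓ) ≡ sumTo m (λ ℓ → sgn ℓ * + (m C ℓ) * Δ h ℓ)
  sumTo-alternating-pascal m h = begin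
    sumTo (suc m) (λ ℓ → sgn ℓ * + (suc m C ℓ) * h ℓ)
      ≡⟨ sumTo-cong (suc m) (λ ℓ _ → split ℓ) ⟩
    sumTo (suc m) (λ ℓ → A ℓ + B ℓ)
      ≡⟨ sumTo-+ (suc m) A B ⟩
    (sumTo m A + A (suc m)) + sumTo (suc m) B
      ≡⟨ cong₂ _+_ (trans (cong (λ y → sumTo m A + y) A-top) (+-identityʳ (sumTo m A))) (sumTo-suc m B) ⟩
    sumTo m A + (+ 0 + sumTo m (λ ℓ → B (suc ℓ)))
      ≡⟨ cong (λ y → sumTo m A + y) (+-identityˡ _) ⟩
    sumTo m A + sumTo m (λ ℓ → B (suc ℓ))
      ≡⟨ sumTo-+ m A (λ ℓ → B (suc ℓ)) ⟨
    sumTo m (λ ℓ → A ℓ + B (suc ℓ))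
      ≡⟨ sumTo-cong m (λ ℓ _ → telescope ℓ) ⟩
    sumTo m (λ ℓ → sgn ℓ * + (m C ℓ) * Δ h ℓ)
      ∎
    where
    A B : ℕ → ℤ
    A ℓ = sgn ℓ * + (m C ℓ) * h ℓ
    B ℓ = sgn ℓ * binomℤ m (+ ℓ - + 1) * h ℓ
    split : ∀ ℓ → sgn ℓ * + (suc m C ℓ) * h ℓ ≡ A ℓ + B ℓ
    split ℓ = trans (cong (λ c → sgn ℓ * c * h ℓ) (binomℤ-pascal m (+ ℓ))) (distrib (sgn ℓ) _ _ (h ℓ))
      where
      distrib : ∀ s c c′ x → s * (c + c′) * x ≡ s * c * x + s * c′ * x
      distrib = solve-∀
    A-top : A (suc m) ≡ + 0
    A-top = zero-coefficient (sgn (suc m)) (h (suc m)) (k>n⇒nCk≡0 (ℕ.n<1+n m))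
    telescope : ∀ ℓ → A ℓ + B (suc ℓ) ≡ sgn ℓ * + (m C ℓ) * Δ h ℓ
    telescope ℓ = trans (cong (λ s → A ℓ + s * + (m C ℓ) * h (suc ℓ)) (sgn-suc ℓ))
                        (difference (sgn ℓ) (+ (m C ℓ)) (h ℓ) (h (suc ℓ)))
      where
      difference : ∀ s c x y → s * c * x + - s * c * y ≡ s * c * (x - y)
      difference = solve-∀

  eigSummand : ℕ → ℤ → ℕ → ℕ → ℤ
  eigSummand m d j ℓ = sgn ℓ * + (j C ℓ) * (binomℤ m (d + + ℓ) * binomℤ m (d + + ℓ))

  eig-unfold : ∀ k i j {N m} → k ∸ i ≡ N → k ∸ j ≡ m → eig k i j ≡ sumTo N (eigSummand m (+ i - + j) j)
  eig-unfold k i j refl refl = refl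

  second-difference-mod4 : ∀ ℓ c x y z →
    + 4 ∣ sgn ℓ * c * ((x * x - y * y) - (y * y - z * z))
          - (sgn ℓ * c * ((z + + 2 * y + x) * (z + + 2 * y + x)) + + 2 * (c * (y * y + z * x)))
  second-difference-mod4 ℓ c x y z with sgn ℓ | sgn≡±1 ℓ
  ... | _ | inj₁ refl = divides (c * (- (+ 2 * y * y) - x * y - y * z - x * z)) (plus c x y z)
    where
    plus : ∀ c x y z → + 1 * c * ((x * x - y * y) - (y * y - z * z))
                       - (+ 1 * c * ((z + + 2 * y + x) * (z + + 2 * y + x)) + + 2 * (c * (y * y + z * x)))
                       ≡ c * (- (+ 2 * y * y) - x * y - y * z - x * z) * + 4
    plus = solve-∀
  ... | _ | inj₂ refl = divides (c * (y * y + x * y + y * z)) (minus c x y z)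
    where
    minus : ∀ c x y z → - + 1 * c * ((x * x - y * y) - (y * y - z * z))
                        - (- + 1 * c * ((z + + 2 * y + x) * (z + + 2 * y + x)) + + 2 * (c * (y * y + z * x)))
                        ≡ c * (y * y + x * y + y * z) * + 4
    minus = solve-∀

  odd⇒4∣2[m-1] : ∀ m → parity m ≡ 1ℙ → + 4 ∣ + 2 * (+ m - + 1)
  odd⇒4∣2[m-1] m odd-m with halving m
  ... | even h = ⊥-elim (p≢p⁻¹ 0ℙ (trans (sym (parity-double h)) odd-m))
  ... | odd h  = divides (+ h) (trans (cong (λ y → + 2 * (+ 1 + y - + 1)) (trans (cong +_ (double≡+ h)) (pos-+ h h)))
                                      (quadruple (+ h)))
    where
    quadruple : ∀ h → + 2 * (+ 1 + (h + h) - + 1) ≡ h * + 4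
    quadruple = solve-∀

  module _ (a n : ℕ) where

    k : ℕ
    k = suc (a ℕ.+ suc n)

    x : ℕ → ℤ
    x ℓ = binomℤ n ((+ suc n - + suc (suc a)) + + ℓ)

    x² : ℕ → ℤ
    x² ℓ = x ℓ * x ℓ

    eig-upper : eig k (suc n) (suc (suc a)) ≡ sumTo a (λ ℓ → sgn ℓ * + (a C ℓ) * Δ (Δ x²) ℓ)
    eig-upper = begin
      eig k (suc n) (suc (suc a))
        ≡⟨ eig-unfold k (suc n) (suc (suc a)) (m+n∸n≡m (suc a) (suc n))
                      (trans (cong (_∸ suc a) (+-suc a n)) (m+n∸m≡n (suc a) n)) ⟩
      sumTo (suc a) F
        ≡⟨ +-identityʳ _ ⟨
      sumTo (suc a) F + + 0
        ≡⟨ cong (λ y → sumTo (suc a) F + y) F-top ⟨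
      sumTo (suc (suc a)) F
        ≡⟨ sumTo-alternating-pascal (suc a) x² ⟩
      sumTo (suc a) (λ ℓ → sgn ℓ * + (suc a C ℓ) * Δ x² ℓ)
        ≡⟨ sumTo-alternating-pascal a (Δ x²) ⟩
      sumTo a (λ ℓ → sgn ℓ * + (a C ℓ) * Δ (Δ x²) ℓ)
        ∎
      where
      F : ℕ → ℤ
      F ℓ = sgn ℓ * + (suc (suc a) C ℓ) * x² ℓ
      cancel : ∀ s y → (s - y) + y ≡ s
      cancel = solve-∀
      x-top : x (suc (suc a)) ≡ + 0
      x-top = trans (cong (binomℤ n) (cancel (+ suc n) (+ suc (suc a)))) (cong +_ (k>n⇒nCk≡0 (ℕ.n<1+n n)))
      F-top : F (suc (suc a)) ≡ + 0
      F-top = trans (cong (λ y → sgn (suc (suc a)) * + (suc (suc a) C suc (suc a)) * (y * y)) x-top)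
                    (*-zeroʳ (sgn (suc (suc a)) * + (suc (suc a) C suc (suc a))))

    pascalTerm : ℕ → ℤ
    pascalTerm ℓ = x (suc (suc ℓ)) + + 2 * x (suc ℓ) + x ℓ

    eig-lower : eig k (suc n) a ≡ sumTo a (λ ℓ → sgn ℓ * + (a C ℓ) * (pascalTerm ℓ * pascalTerm ℓ))
    eig-lower = begin
      eig k (suc n) a
        ≡⟨ eig-unfold k (suc n) a (m+n∸n≡m (suc a) (suc n))
                      (trans (cong (_∸ a) (sym (+-suc a (suc n)))) (m+n∸m≡n a (suc (suc n)))) ⟩
      sumTo a G + G (suc a)
        ≡⟨ cong (λ y → sumTo a G + y) G-top ⟩
      sumTo a G + + 0
        ≡⟨ +-identityʳ _ ⟩
      sumTo a G
        ≡⟨ sumTo-cong a (λ ℓ _ → cong (λ y → sgn ℓ * + (a C ℓ) * (y * y)) (pascal ℓ)) ⟩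
      sumTo a (λ ℓ → sgn ℓ * + (a C ℓ) * (pascalTerm ℓ * pascalTerm ℓ))
        ∎
      where
      G : ℕ → ℤ
      G = eigSummand (suc (suc n)) (+ suc n - + a) a
      G-top : G (suc a) ≡ + 0
      G-top = zero-coefficient (sgn (suc a)) _ (k>n⇒nCk≡0 (ℕ.n<1+n a))
      shift₀ : ∀ s A L → (s - A) + L ≡ (s - (+ 2 + A)) + (+ 2 + L)
      shift₀ = solve-∀
      shift₁ : ∀ s A L → (s - A) + L - + 1 ≡ (s - (+ 2 + A)) + (+ 1 + L)
      shift₁ = solve-∀
      shift₂ : ∀ s A L → (s - A) + L - + 2 ≡ (s - (+ 2 + A)) + L
      shift₂ = solve-∀
      pascal : ∀ ℓ → binomℤ (suc (suc n)) ((+ suc n - + a) + + ℓ) ≡ pascalTerm ℓ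
      pascal ℓ = begin
        binomℤ (suc (suc n)) u
          ≡⟨ binomℤ-pascal₂ n u ⟩
        binomℤ n u + + 2 * binomℤ n (u - + 1) + binomℤ n (u - + 2)
          ≡⟨ cong (λ y → binomℤ n y + + 2 * binomℤ n (u - + 1) + binomℤ n (u - + 2)) (shift₀ (+ suc n) (+ a) (+ ℓ)) ⟩
        x (suc (suc ℓ)) + + 2 * binomℤ n (u - + 1) + binomℤ n (u - + 2)
          ≡⟨ cong (λ y → x (suc (suc ℓ)) + + 2 * binomℤ n y + binomℤ n (u - + 2)) (shift₁ (+ suc n) (+ a) (+ ℓ)) ⟩
        x (suc (suc ℓ)) + + 2 * x (suc ℓ) + binomℤ n (u - + 2)
          ≡⟨ cong (λ y → x (suc (suc ℓ)) + + 2 * x (suc ℓ) + binomℤ n y) (shift₂ (+ suc n) (+ a) (+ ℓ)) ⟩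
        pascalTerm ℓ
          ∎
        where
        u : ℤ
        u = (+ suc n - + a) + + ℓ

    quadTerm : ℕ → ℤ
    quadTerm ℓ = + (a C ℓ) * (x (suc ℓ) * x (suc ℓ) + x (suc (suc ℓ)) * x ℓ)

    quadSum-reflected : sumTo a quadTerm ≡ + quadSum a n
    quadSum-reflected = begin
      sumTo a quadTerm                         ≡⟨ sumTo-reverse a quadTerm ⟩
      sumTo a (λ t → quadTerm (a ∸ t))         ≡⟨ sumTo-cong a reflect ⟩
      sumTo a (λ t → + ((a C t) ℕ.* ((n C t) ℕ.* (n C t) ℕ.+ binomPrev n t ℕ.* (n C suc t))))
                                               ≡⟨ sumTo-pos a _ ⟩
      + quadSum a n                            ∎
      where
      fold : ∀ s A J T → (s - (+ 2 + A)) + (J + (A - T)) ≡ (s - + 1) - ((+ 1 + T) - J)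
      fold = solve-∀
      x-reflected : ∀ j t → t ≤ a → x (j ℕ.+ (a ∸ t)) ≡ binomℤ n ((+ 1 + + t) - + j)
      x-reflected j t t≤a = begin
        binomℤ n ((+ suc n - + suc (suc a)) + + (j ℕ.+ (a ∸ t)))
          ≡⟨ cong (λ y → binomℤ n ((+ suc n - + suc (suc a)) + y))
                  (trans (pos-+ j (a ∸ t)) (cong (λ y → + j + y) a∸t)) ⟩
        binomℤ n ((+ suc n - + suc (suc a)) + (+ j + (+ a - + t)))
          ≡⟨ cong (binomℤ n) (fold (+ suc n) (+ a) (+ j) (+ t)) ⟩
        binomℤ n (+ n - ((+ 1 + + t) - + j))
          ≡⟨ binomℤ-sym n _ ⟩
        binomℤ n ((+ 1 + + t) - + j)
          ∎
        where
        a∸t : + (a ∸ t) ≡ + a - + t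
        a∸t = sym (trans (m-n≡m⊖n a t) (⊖-≥ t≤a))
      reflect : ∀ t → t ≤ a →
        quadTerm (a ∸ t) ≡ + ((a C t) ℕ.* ((n C t) ℕ.* (n C t) ℕ.+ binomPrev n t ℕ.* (n C suc t)))
      reflect t t≤a = begin
        + (a C (a ∸ t)) * (x (suc (a ∸ t)) * x (suc (a ∸ t)) + x (suc (suc (a ∸ t))) * x (a ∸ t))
          ≡⟨ cong₂ (λ c y → + c * (y * y + x (suc (suc (a ∸ t))) * x (a ∸ t))) (sym (nCk≡nC[n∸k] t≤a)) x₁ ⟩
        + (a C t) * (+ (n C t) * + (n C t) + x (suc (suc (a ∸ t))) * x (a ∸ t))
          ≡⟨ cong₂ (λ y z → + (a C t) * (+ (n C t) * + (n C t) + y * z)) x₂ x₀ ⟩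
        + (a C t) * (+ (n C t) * + (n C t) + + binomPrev n t * + (n C suc t))
          ≡⟨ pos-homo ⟨
        + ((a C t) ℕ.* ((n C t) ℕ.* (n C t) ℕ.+ binomPrev n t ℕ.* (n C suc t)))
          ∎
        where
        down₁ : ∀ T → (+ 1 + T) - + 1 ≡ T
        down₁ = solve-∀
        down₂ : ∀ T → (+ 1 + T) - + 2 ≡ T - + 1
        down₂ = solve-∀
        x₁ : x (suc (a ∸ t)) ≡ + (n C t)
        x₁ = trans (x-reflected 1 t t≤a) (cong (binomℤ n) (down₁ (+ t)))
        x₂ : x (suc (suc (a ∸ t))) ≡ + binomPrev n t
        x₂ = trans (x-reflected 2 t t≤a) (trans (cong (binomℤ n) (down₂ (+ t))) (binomℤ-pred n t))
        x₀ : x (a ∸ t) ≡ + (n C suc t)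
        x₀ = trans (x-reflected 0 t t≤a) (cong (binomℤ n) (+-identityʳ (+ 1 + + t)))
        pos-homo : + ((a C t) ℕ.* ((n C t) ℕ.* (n C t) ℕ.+ binomPrev n t ℕ.* (n C suc t)))
                 ≡ + (a C t) * (+ (n C t) * + (n C t) + + binomPrev n t * + (n C suc t))
        pos-homo = trans (pos-* (a C t) _) (cong (λ y → + (a C t) * y) (trans (pos-+ ((n C t) ℕ.* (n C t)) _)
                     (cong₂ _+_ (pos-* (n C t) (n C t)) (pos-* (binomPrev n t) (n C suc t)))))

    gap≡2quadSum-mod4 : + 4 ∣ eig k (suc n) (suc (suc a)) - eig k (suc n) a - + 2 * + quadSum a n
    gap≡2quadSum-mod4 = subst (+ 4 ∣_) (sym rearranged) (sumTo-∣-cong a U L+2Q (λ ℓ _ →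
      second-difference-mod4 ℓ (+ (a C ℓ)) (x ℓ) (x (suc ℓ)) (x (suc (suc ℓ)))))
      where
      U L Q L+2Q : ℕ → ℤ
      U ℓ = sgn ℓ * + (a C ℓ) * Δ (Δ x²) ℓ
      L ℓ = sgn ℓ * + (a C ℓ) * (pascalTerm ℓ * pascalTerm ℓ)
      Q ℓ = quadTerm ℓ
      L+2Q ℓ = L ℓ + + 2 * Q ℓ
      regroup : ∀ u l q → u - l - + 2 * q ≡ u - (l + + 2 * q)
      regroup = solve-∀
      rearranged : eig k (suc n) (suc (suc a)) - eig k (suc n) a - + 2 * + quadSum a n
                 ≡ sumTo a U - sumTo a L+2Q
      rearranged = begin
        eig k (suc n) (suc (suc a)) - eig k (suc n) a - + 2 * + quadSum a n
          ≡⟨ cong₂ (λ u l → u - l - + 2 * + quadSum a n) eig-upper eig-lower ⟩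
        sumTo a U - sumTo a L - + 2 * + quadSum a n
          ≡⟨ cong (λ q → sumTo a U - sumTo a L - + 2 * q) quadSum-reflected ⟨
        sumTo a U - sumTo a L - + 2 * sumTo a Q
          ≡⟨ regroup (sumTo a U) (sumTo a L) (sumTo a Q) ⟩
        sumTo a U - (sumTo a L + + 2 * sumTo a Q)
          ≡⟨ cong (λ q → sumTo a U - (sumTo a L + q)) (sumTo-*ˡ a (+ 2) Q) ⟨
        sumTo a U - (sumTo a L + sumTo a (λ ℓ → + 2 * Q ℓ))
          ≡⟨ cong (λ q → sumTo a U - q) (sumTo-+ a L (λ ℓ → + 2 * Q ℓ)) ⟨
        sumTo a U - sumTo a L+2Q
          ∎

    eigenvalue-gap-mod4 : parity (quadSum a n) ≡ 1ℙ →
      + 4 Unsigned.∣ (eig k (suc n) ((k ∸ suc n) ℕ.+ 1) - eig k (suc n) ((k ∸ suc n) ∸ 1)) - + 2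
    eigenvalue-gap-mod4 odd-quadSum =
      ∣⇒∣ᵤ (subst (+ 4 ∣_) (sym split) (∣m∣n⇒∣m+n gap≡2quadSum-mod4 (odd⇒4∣2[m-1] (quadSum a n) odd-quadSum)))
      where
      k∸i : k ∸ suc n ≡ suc a
      k∸i = m+n∸n≡m (suc a) (suc n)
      regroup : ∀ u l p → u - l - + 2 ≡ (u - l - + 2 * p) + + 2 * (p - + 1)
      regroup = solve-∀
      split : (eig k (suc n) ((k ∸ suc n) ℕ.+ 1) - eig k (suc n) ((k ∸ suc n) ∸ 1)) - + 2
            ≡ (eig k (suc n) (suc (suc a)) - eig k (suc n) a - + 2 * + quadSum a n) + + 2 * (+ quadSum a n - + 1)
      split = trans (cong₂ (λ j j′ → eig k (suc n) j - eig k (suc n) j′ - + 2)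
                           (trans (cong (ℕ._+ 1) k∸i) (ℕ.+-comm (suc a) 1)) (cong (_∸ 1) k∸i))
                    (regroup (eig k (suc n) (suc (suc a))) (eig k (suc n) a) (+ quadSum a n))

open import Defs
open import Data.Nat using (ℕ; _≤_; _∸_; _+_)
open import Data.Nat.Combinatorics using (_C_)
open import Data.Nat.DivMod using (_%_)
open import Relation.Binary.PropositionalEquality using (_≡_)
open import Data.Integer using (+_; _-_)
open import Data.Integer.Divisibility using (_∣_)

open import Data.Nat using (zero; suc; parity)
open import Data.Nat.Properties using (+-comm; m≤n⇒∃[o]m+o≡n)
open import Data.Parity.Base using (0ℙ; 1ℙ)
open import Data.Parity.Properties using (p≢p⁻¹)
open import Data.Empty using (⊥-elim)
open import Data.Product using (_,_)
open import Relation.Binary.PropositionalEquality using (refl; sym; trans; cong; subst)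
open BinomialsModTwo using (double; double-+; double-cancel-≤; halving; even; odd; parity-double; binomℙ; binomℙ-even-even; binomℙ-even-odd; quadSum-odd)
open AlternatingSums using (eigenvalue-gap-mod4)

%2≡1⇒parity≡1ℙ : ∀ n → n % 2 ≡ 1 → parity n ≡ 1ℙ
%2≡1⇒parity≡1ℙ zero          ()
%2≡1⇒parity≡1ℙ (suc zero)    _       = refl
%2≡1⇒parity≡1ℙ (suc (suc n)) n%2≡1 = %2≡1⇒parity≡1ℙ n n%2≡1

lemma3p16 : (k i : ℕ) → 2 ≤ k → 1 ≤ i → i ≤ k ∸ 1 →
    (k C i) % 2 ≡ 1 → ((k ∸ 1) C i) % 2 ≡ 1 → k % 2 ≡ 1 →
    + 4 ∣ ((eig k i ((k ∸ i) + 1) - eig k i ((k ∸ i) ∸ 1)) - + 2)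
-- The hypotheses 2 ≤ k and (k C i) odd follow from the others (the latter by Lucas's theorem).
lemma3p16 k i _ 1≤i i≤k-1 _ odd-C odd-k with halving k | halving i
... | even K | _      = ⊥-elim (p≢p⁻¹ 0ℙ (trans (sym (parity-double K)) (%2≡1⇒parity≡1ℙ k odd-k)))
... | odd K  | odd I  = ⊥-elim (p≢p⁻¹ 0ℙ (trans (sym (binomℙ-even-odd K I)) (%2≡1⇒parity≡1ℙ (double K C suc (double I)) odd-C)))
... | odd K  | even zero with 1≤i
...   | ()
lemma3p16 k i _ 1≤i i≤k-1 _ odd-C odd-k | odd K | even (suc J) with m≤n⇒∃[o]m+o≡n (double-cancel-≤ i≤k-1)
... | A , refl =
  subst Gap (cong suc shape) (eigenvalue-gap-mod4 (double A) (suc (double J)) (quadSum-odd A J odd-binom))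
  where
  i′ : ℕ
  i′ = double (suc J)
  Gap : ℕ → Set
  Gap k = + 4 ∣ ((eig k i′ ((k ∸ i′) + 1) - eig k i′ ((k ∸ i′) ∸ 1)) - + 2)
  shape : double A + suc (suc (double J)) ≡ double (suc J + A)
  shape = trans (+-comm (double A) _) (sym (double-+ (suc J) A))
  odd-binom : binomℙ (A + suc J) (suc J) ≡ 1ℙ
  odd-binom = trans (cong (λ m → binomℙ m (suc J)) (+-comm A (suc J)))
                    (trans (sym (binomℙ-even-even (suc J + A) (suc J)))
                           (%2≡1⇒parity≡1ℙ (double (suc J + A) C double (suc J)) odd-C))
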